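{- Let $P$ be a pseudodiagram. If $P$ is U2, then $P\#*$ is U1. Similarly, if $P$ is K2, then $P\#*$ is K1.
   Context: A knot pseudodiagram is a knot projection in which each crossing is resolved or unresolved, taken up to planar isotopy and Reidemeister moves; $\#$ is connected sum. In the knotting-unknotting game the Knotter and Unknotter alternately resolve one unresolved crossing; when none remain, the Unknotter wins iff the knot is the unknot. A position is U1 (resp. K1) if the Unknotter (resp. Knotter) can force a win moving first, and U2 (resp. K2) if he/she can force a win moving second. $*$ is the one-crossing kink diagram of the unknot with its crossing unresolved. -}

module Defs where

-- Knot pseudodiagrams as (unoriented) planar-diagram (PD) codes.
--
-- A crossing  X a b c d s  lists the four edge labels met going
-- COUNTERCLOCKWISE around the crossing; the two strands through it are
-- a–c and b–d.  The state s says whether the crossing is unresolved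
-- (a precrossing), or resolved with the a–c strand UNDER (acU) or with
-- the b–d strand under (bdU).  (So  X a b c d acU  is the usual KnotTheory
-- PD symbol X[a,b,c,d].)  The empty code is the crossingless circle.

open import Data.Nat.Base using (ℕ; zero; suc; _+_; _*_; _≤ᵇ_; _≡ᵇ_; _<_)
open import Data.Nat.DivMod using (_/_; _%_)
open import Data.Bool.Base using (Bool; true; false; if_then_else_; not; _∧_)
open import Data.List.Base using (List; []; _∷_; length; upTo)
open import Data.List.Relation.Unary.All using (All)
open import Data.List.Relation.Unary.Unique.Propositional using (Unique)
open import Data.List.Membership.Propositional using (_∉_)
open import Data.List.Relation.Binary.Permutation.Propositional using (_↭_)
open import Data.Maybe.Base using (Maybe; just; nothing)
open import Data.Product.Base using (Σ; _×_; _,_)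
open import Data.Sum.Base using (_⊎_)
open import Relation.Binary.PropositionalEquality using (_≡_; _≢_)
open import Relation.Binary.Construct.Closure.Equivalence using (EqClosure)
open import Relation.Nullary using (¬_)

data Res : Set where
  acU bdU : Res

data State : Set where
  pre : State
  res : Res → State

data Crossing : Set where
  X : ℕ → ℕ → ℕ → ℕ → State → Crossing

Code : Set
Code = List Crossing

-- all edge labels, slot by slot; the k-th entry is "dart" k
-- (crossing k / 4, slot k % 4)
labels : Code → List ℕ
labels [] = []
labels (X a b c d _ ∷ R) = a ∷ b ∷ c ∷ d ∷ labels R

nth : List ℕ → ℕ → Maybe ℕ
nth [] _ = nothing
nth (x ∷ xs) zero = just x
nth (x ∷ xs) (suc k) = nth xs k

nth0 : List ℕ → ℕ → ℕ
nth0 [] _ = 0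
nth0 (x ∷ xs) zero = x
nth0 (x ∷ xs) (suc k) = nth0 xs k

count : (ℕ → Bool) → List ℕ → ℕ
count p [] = 0
count p (x ∷ xs) = if p x then suc (count p xs) else count p xs

TwiceValid : Code → Set
TwiceValid C = All (λ l → count (l ≡ᵇ_) (labels C) ≡ 2) (labels C)

partner : List ℕ → ℕ → ℕ
partner lab k = go (upTo (length lab))
  where
  go : List ℕ → ℕ
  go [] = k
  go (j ∷ js) = if not (j ≡ᵇ k) ∧ (nth0 lab j ≡ᵇ nth0 lab k) then j else go js

nextCCW : ℕ → ℕ
nextCCW k = 4 * (k / 4) + (suc (k % 4)) % 4

opposite : ℕ → ℕ
opposite k = 4 * (k / 4) + (2 + k % 4) % 4

iter : (ℕ → ℕ) → ℕ → ℕ → ℕ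
iter f zero x = x
iter f (suc n) x = f (iter f n x)

allB : (ℕ → Bool) → List ℕ → Bool
allB p [] = true
allB p (x ∷ xs) = p x ∧ allB p xs

-- number of cycles of a permutation f of {0,…,m-1}
-- (count the elements that are the least element of their cycle)
cycles : (ℕ → ℕ) → ℕ → ℕ
cycles f m = count (λ d → allB (λ i → d ≤ᵇ iter f (suc i) d) (upTo m)) (upTo m)

faces : Code → ℕ
faces C = cycles (λ k → nextCCW (partner (labels C) k)) (length (labels C))

-- directed strand traversals = cycles of (opposite slot) ∘ (edge involution);
-- each component is traversed in two directions
traversals : Code → ℕ
traversals C = cycles (λ k → opposite (partner (labels C) k)) (length (labels C))

-- a pseudodiagram (of a knot): a well-formed PD code on the sphere
-- (V - E + F = n - 2n + F = 2) with exactly one component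
PseudoDiagram : Code → Set
PseudoDiagram C =
  TwiceValid C × (C ≡ [] ⊎ (traversals C ≡ 2 × faces C ≡ length C + 2))

flipS : State → State
flipS pre = pre
flipS (res acU) = res bdU
flipS (res bdU) = res acU

renL : ℕ → ℕ → ℕ → ℕ
renL a b l = if l ≡ᵇ a then b else l

ren : ℕ → ℕ → Code → Code
ren a b [] = []
ren a b (X p q r s t ∷ R) = X (renL a b p) (renL a b q) (renL a b r) (renL a b s) t ∷ ren a b R

data Step : Code → Code → Set where
  perm : ∀ {C D} → C ↭ D → Step C D
  -- the same crossing, listed starting from the next slot
  rot : ∀ {a b c d s R} → Step (X a b c d s ∷ R) (X b c d a (flipS s) ∷ R)
  relabel : ∀ {a b C} → b ∉ labels C → Step C (ren a b C)
  -- R1: remove a kink (loop e between adjacent slots), joining x and y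
  r1 : ∀ {e x y t R} → TwiceValid (X e e x y (res t) ∷ R) → x ≢ y →
       Step (X e e x y (res t) ∷ R) (ren y x R)
  r1₀ : ∀ {e x t} → TwiceValid (X e e x x (res t) ∷ []) →
        Step (X e e x x (res t) ∷ []) []
  -- R2: a strand passing under (t = acU) or over (t = bdU) another twice
  r2 : ∀ {u0 u1 u2 o0 o1 o2 t R} →
       TwiceValid (X u0 o1 u1 o0 (res t) ∷ X u1 o1 u2 o2 (res t) ∷ R) →
       Unique (u0 ∷ o0 ∷ u2 ∷ o2 ∷ []) →
       Step (X u0 o1 u1 o0 (res t) ∷ X u1 o1 u2 o2 (res t) ∷ R)
            (ren u2 u0 (ren o2 o0 R))
  -- R3: strand r (under both, t = acU, or over both, t = bdU) slides across
  -- the crossing of strands p and q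
  r3 : ∀ {p0 p1 p2 q0 q1 q2 r0 r1 r2 σ t R} →
       TwiceValid (X p2 q0 p1 q1 (res σ) ∷ X r1 p1 r0 p0 (res t) ∷ X r2 q1 r1 q2 (res t) ∷ R) →
       Unique (p0 ∷ p2 ∷ q0 ∷ q2 ∷ r0 ∷ r2 ∷ []) →
       Step (X p2 q0 p1 q1 (res σ) ∷ X r1 p1 r0 p0 (res t) ∷ X r2 q1 r1 q2 (res t) ∷ R)
            (X p1 q1 p0 q2 (res σ) ∷ X r2 p2 r1 p1 (res t) ∷ X r1 q0 r0 q1 (res t) ∷ R)

_≈K_ : Code → Code → Set
_≈K_ = EqClosure Step

IsUnknot : Code → Set
IsUnknot C = C ≈K []

stateAt : Code → ℕ → Maybe State
stateAt [] _ = nothing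
stateAt (X _ _ _ _ s ∷ R) zero = just s
stateAt (_ ∷ R) (suc i) = stateAt R i

Unresolved : Code → ℕ → Set
Unresolved C i = stateAt C i ≡ just pre

AllResolved : Code → Set
AllResolved C = ∀ i → ¬ Unresolved C i

resolve : ℕ → Res → Code → Code
resolve _ _ [] = []
resolve zero r (X a b c d _ ∷ R) = X a b c d (res r) ∷ R
resolve (suc i) r (x ∷ R) = x ∷ resolve i r R

data Player : Set where
  Unknotter Knotter : Player

-- UWins p C : with player p to move, the Unknotter can force a win
data UWins : Player → Code → Set where
  uEnd : ∀ {p C} → AllResolved C → IsUnknot C → UWins p C
  uMoveU : ∀ {C} i r → Unresolved C i → UWins Knotter (resolve i r C) → UWins Unknotter C
  uMoveK : ∀ {C} → Σ ℕ (Unresolved C) →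
           (∀ i r → Unresolved C i → UWins Unknotter (resolve i r C)) → UWins Knotter C

-- KWins p C : with player p to move, the Knotter can force a win
data KWins : Player → Code → Set where
  kEnd : ∀ {p C} → AllResolved C → ¬ IsUnknot C → KWins p C
  kMoveK : ∀ {C} i r → Unresolved C i → KWins Unknotter (resolve i r C) → KWins Knotter C
  kMoveU : ∀ {C} → Σ ℕ (Unresolved C) →
           (∀ i r → Unresolved C i → KWins Knotter (resolve i r C)) → KWins Unknotter C

U1 U2 K1 K2 : Code → Set
U1 = UWins Unknotter   -- Unknotter moves first and can force a win
U2 = UWins Knotter     -- Unknotter moves second and can force a win
K1 = KWins Knotter
K2 = KWins Unknotter

-- P # * : connected sum with the unresolved one-crossing kink

setDart : ℕ → ℕ → Code → Code
setDart _ _ [] = []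
setDart zero y (X a b c d s ∷ R) = X y b c d s ∷ R
setDart (suc zero) y (X a b c d s ∷ R) = X a y c d s ∷ R
setDart (suc (suc zero)) y (X a b c d s ∷ R) = X a b y d s ∷ R
setDart (suc (suc (suc zero))) y (X a b c d s ∷ R) = X a b c y s ∷ R
setDart (suc (suc (suc (suc k)))) y (x ∷ R) = x ∷ setDart k y R

-- KinkSum P Q : Q is a diagram of P # *, obtained by inserting an
-- unresolved kink into some edge of P (on either side of the edge)
data KinkSum : Code → Code → Set where
  onEmpty : ∀ {e x} → e ≢ x → KinkSum [] (X e e x x pre ∷ [])
  onEdgeL : ∀ {P k x e y} → nth (labels P) k ≡ just x →
            e ∉ labels P → y ∉ labels P → e ≢ y →
            KinkSum P (X e e x y pre ∷ setDart k y P)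
  onEdgeR : ∀ {P k x e y} → nth (labels P) k ≡ just x →
            e ∉ labels P → y ∉ labels P → e ≢ y →
            KinkSum P (X e e y x pre ∷ setDart k y P)

module Submission where

-- The player who moves first in P # * resolves the new kink
-- crossing (either way) and from then on copies a winning strategy for P
-- as the second player.  A resolved kink does not change the knot type
-- (Reidemeister I), and it never interacts with the other crossings, so
-- every line of play in P is mirrored by one in P # * with the same
-- outcome.

open import Defs
open import Data.Bool.Base using (true; false; T)
open import Data.Empty using (⊥-elim)
open import Function.Base using (_∘′_)
open import Data.List.Base using (List; []; _∷_; _++_)
open import Data.List.Membership.Propositional using (_∈_; _∉_)
open import Data.List.Relation.Unary.All as All using (All; []; _∷_)
open import Data.List.Relation.Unary.Any using (here; there)
open import Data.Maybe.Base using (just)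
open import Data.Nat.Base using (ℕ; zero; suc; _+_; _≡ᵇ_)
open import Data.Nat.Properties using (≡ᵇ⇒≡)
open import Data.Product.Base using (_×_; _,_; proj₁)
open import Data.Unit using (tt)
open import Relation.Binary.Construct.Closure.Equivalence using (transitive; symmetric)
open import Relation.Binary.Construct.Closure.ReflexiveTransitive using (ε; _◅_)
open import Relation.Binary.Construct.Closure.Symmetric using (fwd; bwd)
open import Relation.Binary.PropositionalEquality
open import Relation.Nullary using (¬_)

open ≡-Reasoning

eqᵇ-refl : ∀ a → (a ≡ᵇ a) ≡ true
eqᵇ-refl zero    = refl
eqᵇ-refl (suc a) = eqᵇ-refl a

eqᵇ-false : ∀ {a b} → a ≢ b → (a ≡ᵇ b) ≡ false
eqᵇ-false {a} {b} a≢b with a ≡ᵇ b in eq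
... | true  = ⊥-elim (a≢b (≡ᵇ⇒≡ a b (subst T (sym eq) tt)))
... | false = refl

count-hit : ∀ {p z} A → p z ≡ true → count p (z ∷ A) ≡ suc (count p A)
count-hit A pz rewrite pz = refl

count-miss : ∀ {p z} A → p z ≡ false → count p (z ∷ A) ≡ count p A
count-miss A pz rewrite pz = refl

count-prefix : ∀ p A {B C} → count p B ≡ count p C → count p (A ++ B) ≡ count p (A ++ C)
count-prefix p []      eq = eq
count-prefix p (z ∷ A) eq with p z
... | true  = cong suc (count-prefix p A eq)
... | false = count-prefix p A eq

count-swap : ∀ p a b A → count p (a ∷ b ∷ A) ≡ count p (b ∷ a ∷ A)
count-swap p a b A with p a | p b
... | true  | true  = refl
... | true  | false = refl
... | false | true  = refl
... | false | false = refl

count-fresh : ∀ {l} L → l ∉ L → count (l ≡ᵇ_) L ≡ 0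
count-fresh []      l∉ = refl
count-fresh (z ∷ L) l∉ =
  trans (count-miss L (eqᵇ-false (λ l≡z → l∉ (here l≡z)))) (count-fresh L (λ q → l∉ (there q)))

∈⇒count≢0 : ∀ {l L} → l ∈ L → count (l ≡ᵇ_) L ≢ 0
∈⇒count≢0 {l} (here refl) rewrite eqᵇ-refl l = λ ()
∈⇒count≢0 {l} {z ∷ L} (there l∈) with l ≡ᵇ z
... | true  = λ ()
... | false = ∈⇒count≢0 l∈

count≢0⇒∈ : ∀ {l} L → count (l ≡ᵇ_) L ≢ 0 → l ∈ L
count≢0⇒∈         []      c≢0 = ⊥-elim (c≢0 refl)
count≢0⇒∈ {l} (z ∷ L) c≢0 with l ≡ᵇ z in eq
... | true  = here (≡ᵇ⇒≡ l z (subst T (sym eq) tt))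
... | false = there (count≢0⇒∈ L c≢0)

Twice : List ℕ → Set
Twice L = All (λ l → count (l ≡ᵇ_) L ≡ 2) L

Twice-resp : ∀ {A B} → (∀ l → count (l ≡ᵇ_) A ≡ count (l ≡ᵇ_) B) → Twice B → Twice A
Twice-resp {A} {B} same twiceB = All.tabulate countA
  where
  countA : ∀ {l} → l ∈ A → count (l ≡ᵇ_) A ≡ 2
  countA {l} l∈A = trans (same l) (All.lookup twiceB l∈B)
    where
    l∈B : l ∈ B
    l∈B = count≢0⇒∈ B (λ c≡0 → ∈⇒count≢0 l∈A (trans (same l) c≡0))

Twice-addPair : ∀ {z L} → Twice L → z ∉ L → Twice (z ∷ z ∷ L)
Twice-addPair {z} {L} twice z∉ = countZ ∷ countZ ∷ All.tabulate countL
  where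
  countZ : count (z ≡ᵇ_) (z ∷ z ∷ L) ≡ 2
  countZ = begin
    count (z ≡ᵇ_) (z ∷ z ∷ L)   ≡⟨ count-hit (z ∷ L) (eqᵇ-refl z) ⟩
    suc (count (z ≡ᵇ_) (z ∷ L)) ≡⟨ cong suc (count-hit L (eqᵇ-refl z)) ⟩
    2 + count (z ≡ᵇ_) L         ≡⟨ cong (2 +_) (count-fresh L z∉) ⟩
    2                           ∎
  countL : ∀ {l} → l ∈ L → count (l ≡ᵇ_) (z ∷ z ∷ L) ≡ 2
  countL {l} l∈ =
    let l≢z = λ (l≡z : l ≡ z) → z∉ (subst (_∈ L) l≡z l∈)
    in  trans (count-miss (z ∷ L) (eqᵇ-false l≢z))
        (trans (count-miss L (eqᵇ-false l≢z)) (All.lookup twice l∈))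

setL : ℕ → ℕ → List ℕ → List ℕ
setL _       _ []      = []
setL zero    y (_ ∷ L) = y ∷ L
setL (suc k) y (z ∷ L) = z ∷ setL k y L

count-setL : ∀ p k {x} y L → nth L k ≡ just x → count p (x ∷ setL k y L) ≡ count p (y ∷ L)
count-setL p zero    y (z ∷ L) refl = count-swap p z y L
count-setL p (suc k) {x} y (z ∷ L) at-k = begin
  count p (x ∷ z ∷ setL k y L) ≡⟨ count-swap p x z (setL k y L) ⟩
  count p (z ∷ x ∷ setL k y L) ≡⟨ count-prefix p (z ∷ []) {x ∷ setL k y L} {y ∷ L} (count-setL p k {x} y L at-k) ⟩
  count p (z ∷ y ∷ L)          ≡⟨ count-swap p z y L ⟩
  count p (y ∷ z ∷ L)          ∎

nth∈ : ∀ L k {x} → nth L k ≡ just x → x ∈ L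
nth∈ (z ∷ L) zero    refl = here refl
nth∈ (z ∷ L) (suc k) at-k = there (nth∈ L k at-k)

labels-setDart : ∀ k y C → labels (setDart k y C) ≡ setL k y (labels C)
labels-setDart k                             y []                  = refl
labels-setDart zero                          y (X a b c d s ∷ R) = refl
labels-setDart (suc zero)                    y (X a b c d s ∷ R) = refl
labels-setDart (suc (suc zero))              y (X a b c d s ∷ R) = refl
labels-setDart (suc (suc (suc zero)))        y (X a b c d s ∷ R) = refl
labels-setDart (suc (suc (suc (suc k))))     y (X a b c d s ∷ R) =
  cong (λ M → a ∷ b ∷ c ∷ d ∷ M) (labels-setDart k y R)

stateAt-setDart : ∀ k y C i → stateAt (setDart k y C) i ≡ stateAt C i
stateAt-setDart k                         y []                  i       = refl
stateAt-setDart zero                      y (X a b c d s ∷ R) zero    = refl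
stateAt-setDart zero                      y (X a b c d s ∷ R) (suc i) = refl
stateAt-setDart (suc zero)                y (X a b c d s ∷ R) zero    = refl
stateAt-setDart (suc zero)                y (X a b c d s ∷ R) (suc i) = refl
stateAt-setDart (suc (suc zero))          y (X a b c d s ∷ R) zero    = refl
stateAt-setDart (suc (suc zero))          y (X a b c d s ∷ R) (suc i) = refl
stateAt-setDart (suc (suc (suc zero)))    y (X a b c d s ∷ R) zero    = refl
stateAt-setDart (suc (suc (suc zero)))    y (X a b c d s ∷ R) (suc i) = refl
stateAt-setDart (suc (suc (suc (suc k)))) y (X a b c d s ∷ R) zero    = refl
stateAt-setDart (suc (suc (suc (suc k)))) y (X a b c d s ∷ R) (suc i) = stateAt-setDart k y R i

resolve-setDart : ∀ i r k y C → resolve i r (setDart k y C) ≡ setDart k y (resolve i r C)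
resolve-setDart i       r k                         y []                  = refl
resolve-setDart zero    r zero                      y (X a b c d s ∷ R) = refl
resolve-setDart (suc i) r zero                      y (X a b c d s ∷ R) = refl
resolve-setDart zero    r (suc zero)                y (X a b c d s ∷ R) = refl
resolve-setDart (suc i) r (suc zero)                y (X a b c d s ∷ R) = refl
resolve-setDart zero    r (suc (suc zero))          y (X a b c d s ∷ R) = refl
resolve-setDart (suc i) r (suc (suc zero))          y (X a b c d s ∷ R) = refl
resolve-setDart zero    r (suc (suc (suc zero)))    y (X a b c d s ∷ R) = refl
resolve-setDart (suc i) r (suc (suc (suc zero)))    y (X a b c d s ∷ R) = refl
resolve-setDart zero    r (suc (suc (suc (suc k)))) y (X a b c d s ∷ R) = refl
resolve-setDart (suc i) r (suc (suc (suc (suc k)))) y (X a b c d s ∷ R) =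
  cong (X a b c d s ∷_) (resolve-setDart i r k y R)

labels-resolve : ∀ i r C → labels (resolve i r C) ≡ labels C
labels-resolve i       r []                  = refl
labels-resolve zero    r (X a b c d s ∷ R) = refl
labels-resolve (suc i) r (X a b c d s ∷ R) =
  cong (λ M → a ∷ b ∷ c ∷ d ∷ M) (labels-resolve i r R)

setDart-self : ∀ k {z} C → nth (labels C) k ≡ just z → setDart k z C ≡ C
setDart-self zero                      (X a b c d s ∷ R) refl = refl
setDart-self (suc zero)                (X a b c d s ∷ R) refl = refl
setDart-self (suc (suc zero))          (X a b c d s ∷ R) refl = refl
setDart-self (suc (suc (suc zero)))    (X a b c d s ∷ R) refl = refl
setDart-self (suc (suc (suc (suc k)))) (X a b c d s ∷ R) at-k =
  cong (X a b c d s ∷_) (setDart-self k R at-k)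

renL-hit : ∀ a b → renL a b a ≡ b
renL-hit a b rewrite eqᵇ-refl a = refl

renL-target : ∀ a b → renL a b b ≡ b
renL-target a b with b ≡ᵇ a
... | true  = refl
... | false = refl

renL-miss : ∀ a b {l} → l ≢ a → renL a b l ≡ l
renL-miss a b l≢a rewrite eqᵇ-false l≢a = refl

ren-fresh : ∀ a b C → a ∉ labels C → ren a b C ≡ C
ren-fresh a b []                  a∉ = refl
ren-fresh a b (X p q r s t ∷ R) a∉ =
  cong₂ _∷_ (X-cong (miss (here refl)) (miss (there (here refl)))
                    (miss (there (there (here refl)))) (miss (there (there (there (here refl))))))
            (ren-fresh a b R (λ q → a∉ (there (there (there (there q))))))
  where
  X-cong : ∀ {p′ q′ r′ s′} → p′ ≡ p → q′ ≡ q → r′ ≡ r → s′ ≡ s → X p′ q′ r′ s′ t ≡ X p q r s t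
  X-cong refl refl refl refl = refl
  miss : ∀ {l} → l ∈ labels (X p q r s t ∷ R) → renL a b l ≡ l
  miss l∈ = renL-miss a b (λ l≡a → a∉ (subst (_∈ _) l≡a l∈))

ren-setDart : ∀ a b k z C → ren a b (setDart k z C) ≡ setDart k (renL a b z) (ren a b C)
ren-setDart a b k                         z []                  = refl
ren-setDart a b zero                      z (X p q r s t ∷ R) = refl
ren-setDart a b (suc zero)                z (X p q r s t ∷ R) = refl
ren-setDart a b (suc (suc zero))          z (X p q r s t ∷ R) = refl
ren-setDart a b (suc (suc (suc zero)))    z (X p q r s t ∷ R) = refl
ren-setDart a b (suc (suc (suc (suc k)))) z (X p q r s t ∷ R) =
  cong (_ ∷_) (ren-setDart a b k z R)

nth-ren : ∀ a b k {z} C → nth (labels C) k ≡ just z → nth (labels (ren a b C)) k ≡ just (renL a b z)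
nth-ren a b zero                      (X p q r s t ∷ R) refl = refl
nth-ren a b (suc zero)                (X p q r s t ∷ R) refl = refl
nth-ren a b (suc (suc zero))          (X p q r s t ∷ R) refl = refl
nth-ren a b (suc (suc (suc zero)))    (X p q r s t ∷ R) refl = refl
nth-ren a b (suc (suc (suc (suc k)))) (X p q r s t ∷ R) at-k = nth-ren a b k R at-k

-- A site for a kink in a diagram with label list L: the dart k carrying
-- edge end x is cut; the kink's loop gets the fresh label e and the new
-- edge between kink and dart k the fresh label y.
record FreshSite (k x e y : ℕ) (L : List ℕ) : Set where
  field
    twice   : Twice L
    at-k    : nth L k ≡ just x
    e-fresh : e ∉ L
    y-fresh : y ∉ L
    e≢y     : e ≢ y

  x∈ : x ∈ L
  x∈ = nth∈ L k at-k

  x≢y : x ≢ y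
  x≢y x≡y = y-fresh (subst (_∈ L) x≡y x∈)

FreshSite-resolve : ∀ {k x e y} i r C →
  FreshSite k x e y (labels C) → FreshSite k x e y (labels (resolve i r C))
FreshSite-resolve i r C = subst (FreshSite _ _ _ _) (sym (labels-resolve i r C))

-- the two ways a kink can sit on the edge: which outer end meets x
data Side : Set where
  onLeft onRight : Side

end₂ end₃ : Side → ℕ → ℕ → ℕ
end₂ onLeft  x y = x
end₂ onRight x y = y
end₃ onLeft  x y = y
end₃ onRight x y = x

kink : Side → ℕ → ℕ → ℕ → State → Crossing
kink side e x y s = X e e (end₂ side x y) (end₃ side x y) s

kink-counts : ∀ side {k x e y s} C → nth (labels C) k ≡ just x → ∀ l →
  count (l ≡ᵇ_) (labels (kink side e x y s ∷ setDart k y C))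
    ≡ count (l ≡ᵇ_) (e ∷ e ∷ y ∷ y ∷ labels C)
kink-counts side {k} {x} {e} {y} C at-k l
  rewrite labels-setDart k y C = count-prefix p (e ∷ e ∷ []) {B} {y ∷ y ∷ L} (ends side)
  where
  p = l ≡ᵇ_
  L = labels C
  L′ = setL k y L
  B = end₂ side x y ∷ end₃ side x y ∷ L′
  moved : count p (x ∷ y ∷ L′) ≡ count p (y ∷ y ∷ L)
  moved = trans (count-swap p x y L′)
                (count-prefix p (y ∷ []) {x ∷ L′} {y ∷ L} (count-setL p k y L at-k))
  ends : ∀ side → count p (end₂ side x y ∷ end₃ side x y ∷ L′) ≡ count p (y ∷ y ∷ L)
  ends onLeft  = moved
  ends onRight = trans (count-swap p y x L′) moved

kink-twiceValid : ∀ side {k x e y s} C → FreshSite k x e y (labels C) →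
  TwiceValid (kink side e x y s ∷ setDart k y C)
kink-twiceValid side {k} {x} {e} {y} {s} C site =
  Twice-resp (kink-counts side {k} {x} {e} {y} {s} C at-k)
  (Twice-addPair (Twice-addPair twice y-fresh) e-fresh′)
  where
  open FreshSite site
  e-fresh′ : _ ∉ _ ∷ _ ∷ labels C
  e-fresh′ (here e≡y)         = e≢y e≡y
  e-fresh′ (there (here e≡y)) = e≢y e≡y
  e-fresh′ (there (there e∈)) = e-fresh e∈

≡⇒≈K : ∀ {C D} → C ≡ D → C ≈K D
≡⇒≈K refl = ε

kink-removal : ∀ side t {k x e y} C → FreshSite k x e y (labels C) →
  (kink side e x y (res t) ∷ setDart k y C) ≈K C
kink-removal onLeft t {k} {x} {e} {y} C site =
  fwd (r1 (kink-twiceValid onLeft {s = res t} C site) x≢y) ◅ ≡⇒≈K undo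
  where
  open FreshSite site
  undo : ren y x (setDart k y C) ≡ C
  undo = begin
    ren y x (setDart k y C)            ≡⟨ ren-setDart y x k y C ⟩
    setDart k (renL y x y) (ren y x C) ≡⟨ cong₂ (setDart k) (renL-hit y x) (ren-fresh y x C y-fresh) ⟩
    setDart k x C                      ≡⟨ setDart-self k C at-k ⟩
    C                                  ∎
kink-removal onRight t {k} {x} {e} {y} C site =
  fwd (r1 (kink-twiceValid onRight {s = res t} C site) (λ y≡x → x≢y (sym y≡x)))
    ◅ transitive Step (≡⇒≈K undo) (bwd (relabel y-fresh) ◅ ε)
  where
  open FreshSite site
  undo : ren x y (setDart k y C) ≡ ren x y C
  undo = begin
    ren x y (setDart k y C)            ≡⟨ ren-setDart x y k y C ⟩
    setDart k (renL x y y) (ren x y C) ≡⟨ cong (λ z → setDart k z (ren x y C)) (renL-target x y) ⟩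
    setDart k y (ren x y C)            ≡⟨ setDart-self k (ren x y C) y-at-k ⟩
    ren x y C                          ∎
    where
    y-at-k : nth (labels (ren x y C)) k ≡ just y
    y-at-k = trans (nth-ren x y k C at-k) (cong just (renL-hit x y))

-- 'pad' prepends a resolved crossing (index 0) and otherwise leaves the
-- game untouched: crossing i of C is crossing i+1 of pad C, with the same
-- state, and resolving commutes with pad.  If moreover pad preserves the
-- knot type on positions satisfying an invariant Inv kept by every move,
-- then both players' winning strategies carry over from C to pad C.
module Padding
  (Inv         : Code → Set)
  (inv-resolve : ∀ i r C → Inv C → Inv (resolve i r C))
  (pad         : Code → Code)
  (pad-first   : ∀ C → ¬ Unresolved (pad C) 0)
  (pad-stateAt : ∀ C i → stateAt (pad C) (suc i) ≡ stateAt C i)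
  (pad-resolve : ∀ C i r → resolve (suc i) r (pad C) ≡ pad (resolve i r C))
  (pad-equiv   : ∀ C → Inv C → pad C ≈K C)
  where

  unresolved-pad : ∀ C i → Unresolved C i → Unresolved (pad C) (suc i)
  unresolved-pad C i = trans (pad-stateAt C i)

  unresolved-unpad : ∀ C i → Unresolved (pad C) (suc i) → Unresolved C i
  unresolved-unpad C i = trans (sym (pad-stateAt C i))

  allResolved-pad : ∀ C → AllResolved C → AllResolved (pad C)
  allResolved-pad C done zero    = pad-first C
  allResolved-pad C done (suc i) = done i ∘′ unresolved-unpad C i

  transferU : ∀ {pl} C → Inv C → UWins pl C → UWins pl (pad C)
  transferU C inv (uEnd done unknot) =
    uEnd (allResolved-pad C done) (transitive Step (pad-equiv C inv) unknot)
  transferU C inv (uMoveU i r u win) =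
    uMoveU (suc i) r (unresolved-pad C i u)
      (subst (UWins Knotter) (sym (pad-resolve C i r))
             (transferU (resolve i r C) (inv-resolve i r C inv) win))
  transferU C inv (uMoveK (j , u) wins) = uMoveK (suc j , unresolved-pad C j u) reply
    where
    reply : ∀ i r → Unresolved (pad C) i → UWins Unknotter (resolve i r (pad C))
    reply zero    r u′ = ⊥-elim (pad-first C u′)
    reply (suc i) r u′ =
      subst (UWins Unknotter) (sym (pad-resolve C i r))
            (transferU (resolve i r C) (inv-resolve i r C inv)
                       (wins i r (unresolved-unpad C i u′)))

  transferK : ∀ {pl} C → Inv C → KWins pl C → KWins pl (pad C)
  transferK C inv (kEnd done knotted) =
    kEnd (allResolved-pad C done)
         (λ unknot → knotted (transitive Step (symmetric Step (pad-equiv C inv)) unknot))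
  transferK C inv (kMoveK i r u win) =
    kMoveK (suc i) r (unresolved-pad C i u)
      (subst (KWins Unknotter) (sym (pad-resolve C i r))
             (transferK (resolve i r C) (inv-resolve i r C inv) win))
  transferK C inv (kMoveU (j , u) wins) = kMoveU (suc j , unresolved-pad C j u) reply
    where
    reply : ∀ i r → Unresolved (pad C) i → KWins Knotter (resolve i r (pad C))
    reply zero    r u′ = ⊥-elim (pad-first C u′)
    reply (suc i) r u′ =
      subst (KWins Knotter) (sym (pad-resolve C i r))
            (transferK (resolve i r C) (inv-resolve i r C inv)
                       (wins i r (unresolved-unpad C i u′)))

kink-lemma : ∀ side t {k x e y} P → FreshSite k x e y (labels P) →
  (U2 P → U1 (kink side e x y pre ∷ setDart k y P)) ×
  (K2 P → K1 (kink side e x y pre ∷ setDart k y P))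
kink-lemma side t {k} {x} {e} {y} P site =
  (λ win → uMoveU 0 t refl (transferU P site win)) ,
  (λ win → kMoveK 0 t refl (transferK P site win))
  where
  open Padding (λ C → FreshSite k x e y (labels C)) FreshSite-resolve
    (λ C → kink side e x y (res t) ∷ setDart k y C)
    (λ C ())
    (λ C i → stateAt-setDart k y C i)
    (λ C i r → cong (_ ∷_) (resolve-setDart i r k y C))
    (kink-removal side t)

kink-alone-unknot : ∀ {e x} t → e ≢ x → IsUnknot (X e e x x (res t) ∷ [])
kink-alone-unknot {e} {x} t e≢x = fwd (r1₀ twiceValid) ◅ ε
  where
  twiceValid : TwiceValid (X e e x x (res t) ∷ [])
  twiceValid = Twice-addPair (Twice-addPair [] λ ()) λ { (here e≡x) → e≢x e≡x
                                                       ; (there (here e≡x)) → e≢x e≡x }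

kink-alone-resolved : ∀ {e x} t → AllResolved (X e e x x (res t) ∷ [])
kink-alone-resolved t zero    ()
kink-alone-resolved t (suc i) ()

-- the empty diagram is the unknot, so the Knotter cannot win on it
not-K2-empty : ¬ K2 []
not-K2-empty (kEnd _ knotted)      = knotted ε
not-K2-empty (kMoveU (zero  , ()) _)
not-K2-empty (kMoveU (suc _ , ()) _)

lemma3p7 : (P Q : Code) → PseudoDiagram P → KinkSum P Q →
           (U2 P → U1 Q) × (K2 P → K1 Q)
lemma3p7 .[] _ _ (onEmpty e≢x) =
  (λ _ → uMoveU 0 acU refl (uEnd (kink-alone-resolved acU) (kink-alone-unknot acU e≢x))) ,
  (λ win → ⊥-elim (not-K2-empty win))
lemma3p7 P _ pd (onEdgeL at-k e∉ y∉ e≢y) =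
  kink-lemma onLeft acU P (record { twice = proj₁ pd ; at-k = at-k
                                  ; e-fresh = e∉ ; y-fresh = y∉ ; e≢y = e≢y })
lemma3p7 P _ pd (onEdgeR at-k e∉ y∉ e≢y) =
  kink-lemma onRight acU P (record { twice = proj₁ pd ; at-k = at-k
                                   ; e-fresh = e∉ ; y-fresh = y∉ ; e≢y = e≢y })
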